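{- For every positive integer $s$ there exists $q_0=q_0(s)$ such that for every integer $q\ge q_0$, the complete $(s+1)$-partite graph $K_{q,q,\dots,q}$ (with $s+1$ parts, each of size $q$) contains $s-1$ pairwise edge-disjoint 2-factors whose union can be oriented so that, for all positive integers $c,d$ with $c+d=s+1$, the union of these oriented 2-factors contains no copy of $K_{c,d}$ with all of its edges oriented towards the same part.
   Context: A 2-factor of a graph is a spanning 2-regular subgraph. A copy of $K_{c,d}$ "with all edges oriented towards the same part" means a subgraph isomorphic to the complete bipartite graph $K_{c,d}$ with parts $P,Q$ such that every edge is oriented from $P$ to $Q$, or every edge is oriented from $Q$ to $P$. -}

module Defs where

open import Data.Nat using (ℕ)
open import Data.Fin using (Fin)
open import Data.Product using (Σ; ∃; _×_; _,_)
open import Data.Sum using (_⊎_)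
open import Relation.Nullary using (¬_)
open import Relation.Binary.PropositionalEquality using (_≡_; _≢_)
open import Function.Definitions using (Injective)

-- Vertices of the complete (p)-partite graph K_{q,...,q} with p parts of size q:
-- a vertex is (part index, index within the part).
Vtx : ℕ → ℕ → Set
Vtx p q = Fin p × Fin q

part : ∀ {p q} → Vtx p q → Fin p
part (i , _) = i

KAdj : ∀ {p q} → Vtx p q → Vtx p q → Set
KAdj u v = part u ≢ part v

IsSubgraph : ∀ {p q} → (Vtx p q → Vtx p q → Set) → Set
IsSubgraph {p} {q} E =
  (∀ (u v : Vtx p q) → E u v → E v u) × (∀ (u v : Vtx p q) → E u v → KAdj u v)

TwoRegular : ∀ {p q} → (Vtx p q → Vtx p q → Set) → Set
TwoRegular {p} {q} E =
  ∀ (v : Vtx p q) → Σ (Vtx p q) λ a → Σ (Vtx p q) λ b →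
    a ≢ b × E v a × E v b × (∀ x → E v x → x ≡ a ⊎ x ≡ b)

IsTwoFactor : ∀ {p q} → (Vtx p q → Vtx p q → Set) → Set
IsTwoFactor E = IsSubgraph E × TwoRegular E

PairwiseEdgeDisjoint : ∀ {p q m} → (Fin m → Vtx p q → Vtx p q → Set) → Set
PairwiseEdgeDisjoint {p} {q} {m} F =
  ∀ (k l : Fin m) → k ≢ l → ∀ (u v : Vtx p q) → ¬ (F k u v × F l u v)

Union : ∀ {p q m} → (Fin m → Vtx p q → Vtx p q → Set) → Vtx p q → Vtx p q → Set
Union {m = m} F u v = Σ (Fin m) λ k → F k u v

IsOrientationOf : ∀ {p q} → (Vtx p q → Vtx p q → Set) → (Vtx p q → Vtx p q → Set) → Set
IsOrientationOf {p} {q} D E =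
  (∀ (u v : Vtx p q) → D u v → E u v) ×
  (∀ (u v : Vtx p q) → E u v → D u v ⊎ D v u) ×
  (∀ (u v : Vtx p q) → D u v → ¬ D v u)

HasDirectedKcd : ∀ {p q} → (Vtx p q → Vtx p q → Set) → ℕ → ℕ → Set
HasDirectedKcd {p} {q} D c d =
  Σ (Fin c → Vtx p q) λ f → Σ (Fin d → Vtx p q) λ g →
    Injective _≡_ _≡_ f × Injective _≡_ _≡_ g ×
    (∀ i j → f i ≢ g j) ×
    (∀ i j → D (f i) (g j))

HasSameDirKcd : ∀ {p q} → (Vtx p q → Vtx p q → Set) → ℕ → ℕ → Set
HasSameDirKcd D c d = HasDirectedKcd D c d ⊎ HasDirectedKcd (λ u v → D v u) c d

-- Identify the s + 1 parts with ℤ_{s+1} and every part with ℤ_q.  For k = 0, …, s − 2 the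
-- permutation (i , x) ↦ (i + 1 , x + k) has no fixed points and no 2-cycles (as s + 1 ≥ 3),
-- so its graph is a 2-factor; different k never share an edge, and orienting each factor
-- along its permutation orients their union.  Every arc of a directed K_{c,d} then goes from
-- one part to the next, with y_j ≡ x_i + k_ij (mod q) and 0 ≤ k_ij ≤ s − 2.  Once q > 3(s − 2)
-- these congruences lift to integers R_i ≤ S_j ≤ R_i + (s − 2) with R and S injective, which
-- forces c + d ≤ s.
module Submission where

open import Data.Empty using (⊥)
open import Data.Fin using (Fin; toℕ; fromℕ<; zero; suc)
open import Data.Fin.Properties using (toℕ-fromℕ<; toℕ-injective; toℕ<n; injective⇒≤)
open import Data.List using (allFin)
open import Data.List.Extrema.Nat using (argmax; argmin; f[xs]≤f[argmax]; f[argmin]≤f[xs])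
open import Data.List.Membership.Propositional.Properties using (∈-allFin)
import Data.List.Relation.Unary.All as All
open import Data.Nat using (ℕ; zero; suc; _+_; _∸_; _≤_; _<_; s≤s; s≤s⁻¹; z≤n; NonZero)
open import Data.Nat.DivMod using (_%_; _mod_; %-distribˡ-+; m%n%n≡m%n; [m+n]%n≡m%n; m<n⇒m%n≡m)
open import Data.Nat.Properties
open import Algebra.Properties.CommutativeSemigroup +-commutativeSemigroup
  using (interchange; x∙yz≈y∙xz; xy∙z≈y∙xz)
open import Data.Product using (Σ; _×_; _,_; proj₁; proj₂)
open import Data.Product.Properties using (×-≡,≡→≡)
open import Data.Sum using (_⊎_; inj₁; inj₂; swap)
open import Defs
open import Function using (_∘_; flip)
open import Function.Definitions using (Injective)
open import Relation.Binary.PropositionalEquality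
open import Relation.Nullary using (¬_)

[m%n+o]%n≡[m+o]%n : ∀ m o n .{{_ : NonZero n}} → (m % n + o) % n ≡ (m + o) % n
[m%n+o]%n≡[m+o]%n m o n = begin
  (m % n + o) % n         ≡⟨ %-distribˡ-+ (m % n) o n ⟩
  (m % n % n + o % n) % n ≡⟨ cong (λ t → (t + o % n) % n) (m%n%n≡m%n m n) ⟩
  (m % n + o % n) % n     ≡⟨ %-distribˡ-+ m o n ⟨
  (m + o) % n             ∎
  where open ≡-Reasoning

module _ {n : ℕ} .{{_ : NonZero n}} where

  shift : ℕ → Fin n → Fin n
  shift k x = (toℕ x + k) mod n

  toℕ-shift : ∀ k x → toℕ (shift k x) ≡ (toℕ x + k) % n
  toℕ-shift k x = toℕ-fromℕ< _

  shift-zero : ∀ x → shift 0 x ≡ x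
  shift-zero x = toℕ-injective (begin
    toℕ (shift 0 x) ≡⟨ toℕ-shift 0 x ⟩
    (toℕ x + 0) % n ≡⟨ cong (_% n) (+-identityʳ (toℕ x)) ⟩
    toℕ x % n       ≡⟨ m<n⇒m%n≡m (toℕ<n x) ⟩
    toℕ x           ∎)
    where open ≡-Reasoning

  shift-period : ∀ x → shift n x ≡ x
  shift-period x = toℕ-injective (begin
    toℕ (shift n x) ≡⟨ toℕ-shift n x ⟩
    (toℕ x + n) % n ≡⟨ [m+n]%n≡m%n (toℕ x) n ⟩
    toℕ x % n       ≡⟨ m<n⇒m%n≡m (toℕ<n x) ⟩
    toℕ x           ∎)
    where open ≡-Reasoning

  shift-shift : ∀ a b x → shift b (shift a x) ≡ shift (a + b) x
  shift-shift a b x = toℕ-injective (begin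
    toℕ (shift b (shift a x)) ≡⟨ toℕ-shift b (shift a x) ⟩
    (toℕ (shift a x) + b) % n ≡⟨ cong (λ t → (t + b) % n) (toℕ-shift a x) ⟩
    ((toℕ x + a) % n + b) % n ≡⟨ [m%n+o]%n≡[m+o]%n (toℕ x + a) b n ⟩
    (toℕ x + a + b) % n       ≡⟨ cong (_% n) (+-assoc (toℕ x) a b) ⟩
    (toℕ x + (a + b)) % n     ≡⟨ toℕ-shift (a + b) x ⟨
    toℕ (shift (a + b) x)     ∎)
    where open ≡-Reasoning

  shift-∸ : ∀ {a k} x → k ≤ a → shift k (shift (a ∸ k) x) ≡ shift a x
  shift-∸ {a} {k} x k≤a = trans (shift-shift (a ∸ k) k x) (cong (λ t → shift t x) (m∸n+n≡m k≤a))

  unshift-shift : ∀ {k} x → k ≤ n → shift (n ∸ k) (shift k x) ≡ x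
  unshift-shift {k} x k≤n = begin
    shift (n ∸ k) (shift k x) ≡⟨ shift-shift k (n ∸ k) x ⟩
    shift (k + (n ∸ k)) x     ≡⟨ cong (λ t → shift t x) (m+[n∸m]≡n k≤n) ⟩
    shift n x                 ≡⟨ shift-period x ⟩
    x                         ∎
    where open ≡-Reasoning

  shift-unshift : ∀ {k} x → k ≤ n → shift k (shift (n ∸ k) x) ≡ x
  shift-unshift x k≤n = trans (shift-∸ x k≤n) (shift-period x)

  shift-injective : ∀ {k} → k ≤ n → Injective _≡_ _≡_ (shift k)
  shift-injective {k} k≤n {x} {y} eq = begin
    x                         ≡⟨ unshift-shift x k≤n ⟨
    shift (n ∸ k) (shift k x) ≡⟨ cong (shift (n ∸ k)) eq ⟩
    shift (n ∸ k) (shift k y) ≡⟨ unshift-shift y k≤n ⟩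
    y                         ∎
    where open ≡-Reasoning

  toℕ-shift-back : ∀ {a} x → a < n → toℕ (shift (n ∸ toℕ x) (shift a x)) ≡ a
  toℕ-shift-back {a} x a<n = begin
    toℕ (shift (n ∸ toℕ x) (shift a x)) ≡⟨ cong toℕ (shift-shift a (n ∸ toℕ x) x) ⟩
    toℕ (shift (a + (n ∸ toℕ x)) x)     ≡⟨ toℕ-shift (a + (n ∸ toℕ x)) x ⟩
    (toℕ x + (a + (n ∸ toℕ x))) % n     ≡⟨ cong (_% n) (x∙yz≈y∙xz (toℕ x) a (n ∸ toℕ x)) ⟩
    (a + (toℕ x + (n ∸ toℕ x))) % n     ≡⟨ cong (λ t → (a + t) % n) (m+[n∸m]≡n (<⇒≤ (toℕ<n x))) ⟩
    (a + n) % n                         ≡⟨ [m+n]%n≡m%n a n ⟩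
    a % n                               ≡⟨ m<n⇒m%n≡m a<n ⟩
    a                                   ∎
    where open ≡-Reasoning

  shift-cancelʳ : ∀ {a b} x → a < n → b < n → shift a x ≡ shift b x → a ≡ b
  shift-cancelʳ {a} {b} x a<n b<n eq = begin
    a                                   ≡⟨ toℕ-shift-back x a<n ⟨
    toℕ (shift (n ∸ toℕ x) (shift a x)) ≡⟨ cong (toℕ ∘ shift (n ∸ toℕ x)) eq ⟩
    toℕ (shift (n ∸ toℕ x) (shift b x)) ≡⟨ toℕ-shift-back x b<n ⟩
    b                                   ∎
    where open ≡-Reasoning

  shift-irreflexive : ∀ {t} x → 0 < t → t < n → shift t x ≢ x
  shift-irreflexive {t} x 0<t t<n eq =
    <⇒≢ 0<t (sym (shift-cancelʳ x t<n (≤-trans (s≤s z≤n) t<n) (trans eq (sym (shift-zero x)))))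

injective-within⇒≤ : ∀ {k lo hi} (f : Fin (suc k) → ℕ) → Injective _≡_ _≡_ f →
  (∀ i → lo ≤ f i) → (∀ i → f i ≤ hi) → k + lo ≤ hi
injective-within⇒≤ {k} {lo} {hi} f f-inj lo≤f f≤hi = begin
  k + lo            ≤⟨ +-monoˡ-≤ lo k≤hi∸lo ⟩
  hi ∸ lo + lo      ≡⟨ m∸n+n≡m (≤-trans (lo≤f zero) (f≤hi zero)) ⟩
  hi                ∎
  where
  open ≤-Reasoning
  offset : Fin (suc k) → Fin (suc (hi ∸ lo))
  offset i = fromℕ< (s≤s (∸-monoˡ-≤ lo (f≤hi i)))
  offset-injective : Injective _≡_ _≡_ offset
  offset-injective {i} {j} eq = f-inj (∸-cancelʳ-≡ (lo≤f i) (lo≤f j) (begin-equality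
    f i ∸ lo          ≡⟨ toℕ-fromℕ< _ ⟨
    toℕ (offset i)    ≡⟨ cong toℕ eq ⟩
    toℕ (offset j)    ≡⟨ toℕ-fromℕ< _ ⟩
    f j ∸ lo          ∎))
  k≤hi∸lo : k ≤ hi ∸ lo
  k≤hi∸lo = s≤s⁻¹ (injective⇒≤ offset-injective)

maximum-attained : ∀ {k} (f : Fin (suc k) → ℕ) → Σ (Fin (suc k)) λ m → ∀ i → f i ≤ f m
maximum-attained f =
  argmax f zero (allFin _) , λ i → All.lookup (f[xs]≤f[argmax] {f = f} zero (allFin _)) (∈-allFin i)

minimum-attained : ∀ {k} (f : Fin (suc k) → ℕ) → Σ (Fin (suc k)) λ m → ∀ i → f m ≤ f i
minimum-attained f =
  argmin f zero (allFin _) , λ i → All.lookup (f[argmin]≤f[xs] {f = f} zero (allFin _)) (∈-allFin i)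

-- R lies in [min R, max R] and S in [max R, min R + n]; the two lengths add up to n.
sandwich-bound : ∀ {c d} n (R : Fin (suc c) → ℕ) (S : Fin (suc d) → ℕ) →
  Injective _≡_ _≡_ R → Injective _≡_ _≡_ S →
  (∀ i j → R i ≤ S j) → (∀ i j → S j ≤ R i + n) → c + d ≤ n
sandwich-bound {c} {d} n R S R-inj S-inj R≤S S≤R+n =
  +-cancelʳ-≤ (lo + hi) (c + d) n (begin
    c + d + (lo + hi)     ≡⟨ interchange c d lo hi ⟩
    (c + lo) + (d + hi)   ≤⟨ +-mono-≤ c+lo≤hi d+hi≤lo+n ⟩
    hi + (lo + n)         ≡⟨ +-comm hi (lo + n) ⟩
    lo + n + hi           ≡⟨ xy∙z≈y∙xz lo n hi ⟩
    n + (lo + hi)         ∎)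
  where
  open ≤-Reasoning
  imin imax : Fin (suc c)
  imin = proj₁ (minimum-attained R)
  imax = proj₁ (maximum-attained R)
  lo hi : ℕ
  lo = R imin
  hi = R imax
  c+lo≤hi : c + lo ≤ hi
  c+lo≤hi = injective-within⇒≤ R R-inj (proj₂ (minimum-attained R)) (proj₂ (maximum-attained R))
  d+hi≤lo+n : d + hi ≤ lo + n
  d+hi≤lo+n = injective-within⇒≤ S S-inj (R≤S imax) (S≤R+n imin)

-- Measuring every position from the base point b = x 0 - n turns the cyclic relations
-- y j = x i + k i j into the exact identities R i + k i j = S j below q, i.e. a sandwich.
shift-rectangle-bound : ∀ {q c d} .{{_ : NonZero q}} n → n + n + n < q →
  (x : Fin (suc c) → Fin q) (y : Fin (suc d) → Fin q) (k : Fin (suc c) → Fin (suc d) → ℕ) →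
  Injective _≡_ _≡_ x → Injective _≡_ _≡_ y → (∀ i j → k i j ≤ n) →
  (∀ i j → y j ≡ shift (k i j) (x i)) → c + d ≤ n
shift-rectangle-bound {q} {c} {d} n 3n<q x y k x-inj y-inj k≤n y≡xk =
  sandwich-bound n R S R-inj S-inj
    (λ i j → subst (R i ≤_) (R+k≡S i j) (m≤m+n (R i) (k i j)))
    (λ i j → subst (_≤ R i + n) (R+k≡S i j) (+-monoʳ-≤ (R i) (k≤n i j)))
  where
  n≤q : n ≤ q
  n≤q = ≤-trans (≤-trans (m≤m+n n n) (m≤m+n (n + n) n)) (<⇒≤ 3n<q)
  b : Fin q
  b = shift (q ∸ n) (x zero)
  S : Fin (suc d) → ℕ
  S j = n + k zero j
  R : Fin (suc c) → ℕ
  R i = (n + k zero zero) ∸ k i zero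
  y≡shiftS : ∀ j → y j ≡ shift (S j) b
  y≡shiftS j = begin
    y j                          ≡⟨ y≡xk zero j ⟩
    shift (k zero j) (x zero)    ≡⟨ cong (shift (k zero j)) (shift-unshift (x zero) n≤q) ⟨
    shift (k zero j) (shift n b) ≡⟨ shift-shift n (k zero j) b ⟩
    shift (S j) b                ∎
    where open ≡-Reasoning
  x≡shiftR : ∀ i → x i ≡ shift (R i) b
  x≡shiftR i = shift-injective (≤-trans (k≤n i zero) n≤q) (begin
    shift (k i zero) (x i)         ≡⟨ y≡xk i zero ⟨
    y zero                         ≡⟨ y≡shiftS zero ⟩
    shift (S zero) b               ≡⟨ shift-∸ b (≤-trans (k≤n i zero) (m≤m+n n _)) ⟨
    shift (k i zero) (shift (R i) b) ∎)
    where open ≡-Reasoning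
  R+k≡S : ∀ i j → R i + k i j ≡ S j
  R+k≡S i j = shift-cancelʳ b R+k<q S<q (begin
    shift (R i + k i j) b          ≡⟨ shift-shift (R i) (k i j) b ⟨
    shift (k i j) (shift (R i) b)  ≡⟨ cong (shift (k i j)) (x≡shiftR i) ⟨
    shift (k i j) (x i)            ≡⟨ y≡xk i j ⟨
    y j                            ≡⟨ y≡shiftS j ⟩
    shift (S j) b                  ∎)
    where
    open ≡-Reasoning
    R≤n+n : R i ≤ n + n
    R≤n+n = ≤-trans (m∸n≤m (n + k zero zero) (k i zero)) (+-monoʳ-≤ n (k≤n zero zero))
    R+k<q : R i + k i j < q
    R+k<q = ≤-<-trans (+-mono-≤ R≤n+n (k≤n i j)) 3n<q
    S<q : S j < q
    S<q = ≤-<-trans (≤-trans (+-monoʳ-≤ n (k≤n zero j)) (m≤m+n (n + n) n)) 3n<q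
  R-inj : Injective _≡_ _≡_ R
  R-inj {i} {i′} eq = x-inj (trans (x≡shiftR i) (trans (cong (λ t → shift t b) eq) (sym (x≡shiftR i′))))
  S-inj : Injective _≡_ _≡_ S
  S-inj {j} {j′} eq = y-inj (trans (y≡shiftS j) (trans (cong (λ t → shift t b) eq) (sym (y≡shiftS j′))))

proj₂-injective-on-fibre : ∀ {I A B : Set} (f : I → A × B) → Injective _≡_ _≡_ f →
  (∀ i j → proj₁ (f i) ≡ proj₁ (f j)) → Injective _≡_ _≡_ (proj₂ ∘ f)
proj₂-injective-on-fibre f f-inj same {i} {j} eq = f-inj (×-≡,≡→≡ (same i j , eq))

HasDirectedKcd-flip : ∀ {p q c d} {D : Vtx p q → Vtx p q → Set} →
  HasDirectedKcd (flip D) c d → HasDirectedKcd D d c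
HasDirectedKcd-flip (f , g , f-inj , g-inj , f≢g , arcs) =
  g , f , g-inj , f-inj , (λ j i → f≢g i j ∘ sym) , flip arcs

module _ {p q : ℕ} where

  Arc : (Vtx p q → Vtx p q) → Vtx p q → Vtx p q → Set
  Arc σ u v = v ≡ σ u

  Edge : (Vtx p q → Vtx p q) → Vtx p q → Vtx p q → Set
  Edge σ u v = Arc σ u v ⊎ Arc σ v u

  Edge-isTwoFactor : (σ σ⁻¹ : Vtx p q → Vtx p q) →
    (∀ u → σ (σ⁻¹ u) ≡ u) → (∀ u → σ⁻¹ (σ u) ≡ u) →
    (∀ u → KAdj u (σ u)) → (∀ u → σ (σ u) ≢ u) → IsTwoFactor (Edge σ)
  Edge-isTwoFactor σ σ⁻¹ σσ⁻¹ σ⁻¹σ adjacent no-2-cycle =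
    ((λ _ _ → swap) , subgraph) , twoRegular
    where
    subgraph : ∀ u v → Edge σ u v → KAdj u v
    subgraph u v (inj₁ refl) = adjacent u
    subgraph u v (inj₂ refl) = adjacent v ∘ sym
    twoRegular : TwoRegular (Edge σ)
    twoRegular u = σ u , σ⁻¹ u , distinct , inj₁ refl , inj₂ (sym (σσ⁻¹ u)) , only
      where
      distinct : σ u ≢ σ⁻¹ u
      distinct eq = no-2-cycle u (trans (cong σ eq) (σσ⁻¹ u))
      only : ∀ x → Edge σ u x → x ≡ σ u ⊎ x ≡ σ⁻¹ u
      only x (inj₁ x≡σu) = inj₁ x≡σu
      only x (inj₂ u≡σx) = inj₂ (trans (sym (σ⁻¹σ x)) (cong σ⁻¹ (sym u≡σx)))

  module _ {m : ℕ} (σ : Fin m → Vtx p q → Vtx p q) where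

    Arcs : Vtx p q → Vtx p q → Set
    Arcs u v = Σ (Fin m) λ k → Arc (σ k) u v

    Edge-pairwiseDisjoint : (∀ k l → k ≢ l → ∀ u → σ k u ≢ σ l u) →
      (∀ k l u → σ k (σ l u) ≢ u) → PairwiseEdgeDisjoint (Edge ∘ σ)
    Edge-pairwiseDisjoint separated no-2-cycle k l k≢l u v = λ where
      (inj₁ v≡σku , inj₁ v≡σlu) → separated k l k≢l u (trans (sym v≡σku) v≡σlu)
      (inj₁ v≡σku , inj₂ u≡σlv) → no-2-cycle l k u (trans (cong (σ l) (sym v≡σku)) (sym u≡σlv))
      (inj₂ u≡σkv , inj₁ v≡σlu) → no-2-cycle k l u (trans (cong (σ k) (sym v≡σlu)) (sym u≡σkv))
      (inj₂ u≡σkv , inj₂ u≡σlv) → separated k l k≢l v (trans (sym u≡σkv) u≡σlv)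

    Arcs-isOrientation : (∀ k l u → σ k (σ l u) ≢ u) → IsOrientationOf Arcs (Union (Edge ∘ σ))
    Arcs-isOrientation no-2-cycle =
      (λ _ _ (k , arc) → k , inj₁ arc) ,
      (λ _ _ → λ { (k , inj₁ arc) → inj₁ (k , arc) ; (k , inj₂ arc) → inj₂ (k , arc) }) ,
      λ u v (k , v≡σku) (l , u≡σlv) → no-2-cycle l k u (trans (cong (σ l) (sym v≡σku)) (sym u≡σlv))

module ShiftFactors (r n q : ℕ) .{{_ : NonZero q}} (3n<q : n + n + n < q) where

  V : Set
  V = Vtx (3 + r) q

  step : Fin (suc n) → V → V
  step k (i , x) = shift 1 i , shift (toℕ k) x

  step⁻¹ : Fin (suc n) → V → V
  step⁻¹ k (i , x) = shift (3 + r ∸ 1) i , shift (q ∸ toℕ k) x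

  n<q : n < q
  n<q = ≤-<-trans (≤-trans (m≤m+n n n) (m≤m+n (n + n) n)) 3n<q

  toℕ≤n : ∀ (k : Fin (suc n)) → toℕ k ≤ n
  toℕ≤n k = s≤s⁻¹ (toℕ<n k)

  toℕ<q : ∀ (k : Fin (suc n)) → toℕ k < q
  toℕ<q k = ≤-<-trans (toℕ≤n k) n<q

  1≤3+r : 1 ≤ 3 + r
  1≤3+r = s≤s z≤n

  step-adjacent : ∀ k u → KAdj u (step k u)
  step-adjacent k (i , x) = ≢-sym (shift-irreflexive i (s≤s z≤n) (s≤s (s≤s z≤n)))

  step-step-irreflexive : ∀ k l u → step k (step l u) ≢ u
  step-step-irreflexive k l (i , x) eq =
    shift-irreflexive i (s≤s z≤n) (s≤s (s≤s (s≤s z≤n))) (trans (sym (shift-shift 1 1 i)) (cong proj₁ eq))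

  step-separated : ∀ k l → k ≢ l → ∀ u → step k u ≢ step l u
  step-separated k l k≢l (i , x) eq =
    k≢l (toℕ-injective (shift-cancelʳ x (toℕ<q k) (toℕ<q l) (cong proj₂ eq)))

  factors : Fin (suc n) → V → V → Set
  factors = Edge ∘ step

  factors-isTwoFactor : ∀ k → IsTwoFactor (factors k)
  factors-isTwoFactor k =
    Edge-isTwoFactor (step k) (step⁻¹ k)
      (λ (i , x) → ×-≡,≡→≡ (shift-unshift i 1≤3+r , shift-unshift x (<⇒≤ (toℕ<q k))))
      (λ (i , x) → ×-≡,≡→≡ (unshift-shift i 1≤3+r , unshift-shift x (<⇒≤ (toℕ<q k))))
      (step-adjacent k) (step-step-irreflexive k k)

  directedKcd-bound : ∀ {c d} → HasDirectedKcd (Arcs step) (suc c) (suc d) → c + d ≤ n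
  directedKcd-bound {c} {d} (f , g , f-inj , g-inj , _ , arcs) =
    shift-rectangle-bound n 3n<q (proj₂ ∘ f) (proj₂ ∘ g) shift-amount
      (proj₂-injective-on-fibre f f-inj f-parts) (proj₂-injective-on-fibre g g-inj g-parts)
      (λ i j → toℕ≤n (proj₁ (arcs i j))) (λ i j → cong proj₂ (proj₂ (arcs i j)))
    where
    shift-amount : Fin (suc c) → Fin (suc d) → ℕ
    shift-amount i j = toℕ (proj₁ (arcs i j))
    g-part : ∀ i j → proj₁ (g j) ≡ shift 1 (proj₁ (f i))
    g-part i j = cong proj₁ (proj₂ (arcs i j))
    f-parts : ∀ i i′ → proj₁ (f i) ≡ proj₁ (f i′)
    f-parts i i′ = shift-injective 1≤3+r (trans (sym (g-part i zero)) (g-part i′ zero))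
    g-parts : ∀ j j′ → proj₁ (g j) ≡ proj₁ (g j′)
    g-parts j j′ = trans (g-part zero j) (sym (g-part zero j′))

  noSameDirKcd : ∀ c d → 1 ≤ c → 1 ≤ d → c + d ≡ 3 + n → ¬ HasSameDirKcd (Arcs step) c d
  noSameDirKcd (suc c) (suc d) _ _ c+d≡3+n K = n≮n n (subst (_≤ n) c+d≡1+n (bound K))
    where
    c+d≡1+n : c + d ≡ suc n
    c+d≡1+n = suc-injective (trans (sym (+-suc c d)) (suc-injective c+d≡3+n))
    bound : HasSameDirKcd (Arcs step) (suc c) (suc d) → c + d ≤ n
    bound (inj₁ K) = directedKcd-bound K
    bound (inj₂ K) = subst (_≤ n) (+-comm d c) (directedKcd-bound (HasDirectedKcd-flip {D = Arcs step} K))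

lemma2p3 : ∀ (s : ℕ) → 1 ≤ s →
    Σ ℕ λ q₀ → ∀ (q : ℕ) → q₀ ≤ q →
      Σ (Fin (s ∸ 1) → Vtx (suc s) q → Vtx (suc s) q → Set) λ F →
        (∀ k → IsTwoFactor (F k)) ×
        PairwiseEdgeDisjoint F ×
        Σ (Vtx (suc s) q → Vtx (suc s) q → Set) λ D →
          IsOrientationOf D (Union F) ×
          (∀ (c d : ℕ) → 1 ≤ c → 1 ≤ d → c + d ≡ suc s → ¬ HasSameDirKcd D c d)
lemma2p3 (suc zero) _ = 0 , λ _ _ →
  (λ ()) , (λ ()) , (λ ()) , (λ _ _ → ⊥) ,
  ((λ _ _ ()) , (λ { _ _ (() , _) }) , (λ _ _ ())) ,
  λ { (suc _) (suc _) _ _ _ (inj₁ (_ , _ , _ , _ , _ , arcs)) → arcs zero zero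
    ; (suc _) (suc _) _ _ _ (inj₂ (_ , _ , _ , _ , _ , arcs)) → arcs zero zero }
lemma2p3 (suc (suc n)) _ = suc (n + n + n) , λ where
  (suc q-1) 3n<q → let open ShiftFactors n n (suc q-1) 3n<q in
    factors , factors-isTwoFactor ,
    Edge-pairwiseDisjoint step step-separated step-step-irreflexive ,
    Arcs step , Arcs-isOrientation step step-step-irreflexive ,
    noSameDirKcd
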